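{- For each $n<\omega$ there is a first-order sentence $\varphi_n$ of quantifier rank $n$ that is not expressible by any $\mathcal{L}_{\infty\omega}(\mathcal{Q}_{\mathrm{emb}})$-sentence of quantifier rank $<n$ (i.e. no such sentence is true in exactly the same structures as $\varphi_n$), and $\varphi_n$ is of the form $\varphi_n=Q_nx_n\cdots Q_1x_1\,\vartheta(x_1,\dots,x_n)$, where $Q_n=\forall$ if $n$ is odd, $Q_n=\exists$ if $n$ is even, and $\vartheta$ is quantifier-free.
   Context: A generalized quantifier $Q$ is given by a relational vocabulary $\tau_Q$ and an isomorphism-closed class $K_Q$ of $\tau_Q$-structures; $Q(\overline{x}_R\psi_R)_{R\in\tau_Q}$ holds in $\mathfrak{A}$ (parameters $\overline{a}$) iff $(A,(\psi_R^{\mathfrak{A},\overline{a}})_{R\in\tau_Q})\in K_Q$. $Q$ is embedding-closed if $K_Q$ is closed upward under embeddability (embeddings: injections preserving constants, functions and relations in both directions); $\mathcal{Q}_{\mathrm{emb}}$ is the class of all embedding-closed quantifiers, and $\mathcal{L}_{\infty\omega}(\mathcal{Q}_{\mathrm{emb}})$ is infinitary logic (arbitrary conjunctions/disjunctions) extended by them. Quantifier rank: $\mathrm{qr}(\varphi)=0$ for quantifier-free $\varphi$, $\mathrm{qr}(\neg\varphi)=\mathrm{qr}(\varphi)$, $\mathrm{qr}(\bigwedge\Phi)=\mathrm{qr}(\bigvee\Phi)=\sup\{\mathrm{qr}(\varphi):\varphi\in\Phi\}$, $\mathrm{qr}(Q(\overline{x}_\delta\varphi_\delta)_{\delta<\kappa})=\sup_\delta\mathrm{qr}(\varphi_\delta)+1$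 (with $\exists,\forall$ counted as quantifiers). -}

module Defs where

open import Level using (Level; _⊔_; Lift; Setω) renaming (suc to lsuc; zero to 0ℓ)
open import Data.Nat using (ℕ; zero; suc; _+_)
open import Data.Nat.Base using (_%_)
open import Data.Fin using (Fin)
open import Data.Bool using (Bool; true; false)
open import Data.Unit.Polymorphic using (⊤)
open import Data.Empty.Polymorphic using (⊥)
open import Data.Product using (Σ; _×_; _,_)
open import Data.Sum using (_⊎_)
open import Data.Vec.Functional using (Vector; _∷_; _++_)
open import Relation.Nullary using (¬_)
open import Relation.Binary.PropositionalEquality using (_≡_)
open import Function using (_∘_)
open import Function.Bundles using (_⇔_)

record Vocab (a : Level) : Set (lsuc a) where
  field
    Sym   : Set a
    arity : Sym → ℕ
open Vocab public

record Structure {a : Level} (τ : Vocab a) (ℓ : Level) : Set (a ⊔ lsuc ℓ) where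
  field
    Carrier : Set ℓ
    rel     : (R : Sym τ) → (Fin (arity τ R) → Carrier) → Set ℓ
open Structure public

record Embedding {a ℓ : Level} {τ : Vocab a} (𝔄 𝔅 : Structure τ ℓ) : Set (a ⊔ ℓ) where
  field
    map       : Carrier 𝔄 → Carrier 𝔅
    injective : ∀ x y → map x ≡ map y → x ≡ y
    preserves : ∀ (R : Sym τ) (t : Fin (arity τ R) → Carrier 𝔄) →
                rel 𝔄 R t ⇔ rel 𝔅 R (map ∘ t)

EmbClosed : {ℓ : Level} {σ : Vocab ℓ} → (Structure σ ℓ → Set ℓ) → Set (lsuc ℓ)
EmbClosed {σ = σ} K = ∀ (𝔄 𝔅 : Structure σ _) → Embedding 𝔄 𝔅 → K 𝔄 → K 𝔅

data Fm {a : Level} (ℓ : Level) (τ : Vocab a) : ℕ → Set (a ⊔ lsuc ℓ) where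
  atom : ∀ {n} (R : Sym τ) → (Fin (arity τ R) → Fin n) → Fm ℓ τ n
  eq   : ∀ {n} → Fin n → Fin n → Fm ℓ τ n
  neg  : ∀ {n} → Fm ℓ τ n → Fm ℓ τ n
  conj : ∀ {n} (I : Set ℓ) → (I → Fm ℓ τ n) → Fm ℓ τ n
  disj : ∀ {n} (I : Set ℓ) → (I → Fm ℓ τ n) → Fm ℓ τ n
  ex   : ∀ {n} → Fm ℓ τ (suc n) → Fm ℓ τ n
  all  : ∀ {n} → Fm ℓ τ (suc n) → Fm ℓ τ n
  -- embedding-closed generalized quantifier Q = (σ, K):
  -- Q (x̄_R ψ_R)_{R ∈ σ}, ψ_R binds arity R new variables
  gq   : ∀ {n} (σ : Vocab ℓ) (K : Structure σ ℓ → Set ℓ) → EmbClosed K →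
         ((R : Sym σ) → Fm ℓ τ (arity σ R + n)) → Fm ℓ τ n

-- Satisfaction; the new variable of a quantifier is variable zero,
-- and the tuple bound by a generalized quantifier is prepended.
Sat : ∀ {a ℓ} {τ : Vocab a} {n} (𝔄 : Structure τ ℓ) →
      Fm ℓ τ n → (Fin n → Carrier 𝔄) → Set ℓ
Sat 𝔄 (atom R v)   e = rel 𝔄 R (e ∘ v)
Sat 𝔄 (eq i j)     e = e i ≡ e j
Sat 𝔄 (neg φ)      e = ¬ Sat 𝔄 φ e
Sat 𝔄 (conj I f)   e = ∀ i → Sat 𝔄 (f i) e
Sat 𝔄 (disj I f)   e = Σ I λ i → Sat 𝔄 (f i) e
Sat 𝔄 (ex φ)       e = Σ (Carrier 𝔄) λ x → Sat 𝔄 φ (x ∷ e)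
Sat 𝔄 (all φ)      e = ∀ x → Sat 𝔄 φ (x ∷ e)
Sat 𝔄 (gq σ K _ ψ) e =
  K (record { Carrier = Carrier 𝔄
            ; rel = λ R t → Sat 𝔄 (ψ R) (t ++ e) })

_⊨_ : ∀ {a ℓ} {τ : Vocab a} → Structure τ ℓ → Fm ℓ τ 0 → Set ℓ
𝔄 ⊨ φ = Sat 𝔄 φ (λ ())

RankLe : ∀ {a ℓ} {τ : Vocab a} {n} → ℕ → Fm ℓ τ n → Set ℓ
RankLe m (atom R v)         = ⊤
RankLe m (eq i j)           = ⊤
RankLe m (neg φ)            = RankLe m φ
RankLe m (conj I f)         = ∀ i → RankLe m (f i)
RankLe m (disj I f)         = ∀ i → RankLe m (f i)
RankLe zero (ex φ)          = ⊥
RankLe (suc m) (ex φ)       = RankLe m φ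
RankLe zero (all φ)         = ⊥
RankLe (suc m) (all φ)      = RankLe m φ
RankLe zero (gq σ K _ ψ)    = ⊥
RankLe (suc m) (gq σ K _ ψ) = ∀ R → RankLe m (ψ R)

RankLt : ∀ {a ℓ} {τ : Vocab a} {n} → ℕ → Fm ℓ τ n → Set ℓ
RankLt zero    φ = ⊥
RankLt (suc m) φ = RankLe m φ

data QF {a : Level} (τ : Vocab a) (n : ℕ) : Set a where
  atom : (R : Sym τ) → (Fin (arity τ R) → Fin n) → QF τ n
  eq   : Fin n → Fin n → QF τ n
  neg  : QF τ n → QF τ n
  and  : QF τ n → QF τ n → QF τ n
  or   : QF τ n → QF τ n → QF τ n

qf : ∀ {a} ℓ {τ : Vocab a} {n} → QF τ n → Fm ℓ τ n
qf ℓ (atom R v) = atom R v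
qf ℓ (eq i j)   = eq i j
qf ℓ (neg φ)    = neg (qf ℓ φ)
qf ℓ (and φ ψ)  = conj (Lift ℓ Bool) (λ { (Level.lift true) → qf ℓ φ ; (Level.lift false) → qf ℓ ψ })
qf ℓ (or φ ψ)   = disj (Lift ℓ Bool) (λ { (Level.lift true) → qf ℓ φ ; (Level.lift false) → qf ℓ ψ })

Qlab : ∀ {a ℓ} {τ : Vocab a} {n} → ℕ → Fm ℓ τ (suc n) → Fm ℓ τ n
Qlab j with j % 2
... | 0 = ex
... | _ = all

-- prefix j m θ = Q_{j+m} x ⋯ Q_{j+1} x θ ; so
-- prefix 0 n θ = Q_n x_n ⋯ Q_1 x_1 θ  (x_1 innermost).
prefix : ∀ {a ℓ} {τ : Vocab a} → ℕ → (m : ℕ) → Fm ℓ τ m → Fm ℓ τ 0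
prefix j zero    θ = θ
prefix j (suc m) θ = prefix (suc j) m (Qlab (suc j) θ)

prenexSentence : ∀ {a} ℓ {τ : Vocab a} (n : ℕ) → QF τ n → Fm ℓ τ 0
prenexSentence ℓ n ϑ = prefix 0 n (qf ℓ ϑ)

-- Dependent pair whose second component may be of sort Setω
-- (needed to quantify over all universe levels inside an existential).
record Σω {a : Level} (A : Set a) (B : A → Setω) : Setω where
  constructor _,ω_
  field
    fst : A
    snd : B fst

module Submission where

-- φ_{k+1} describes a game of length k+1 on the ℕ-branching tree of finite
-- lists: x_{k+1} is a child of the root, each x_i a child of x_{i+1}, Q_i
-- chooses x_i, and the play is won when x_1 satisfies won.  Label the nodes
-- with a level and a value, the label of a child being determined by the
-- label of its parent and the parity of its index, and let won hold at the
-- nodes labelled (0 , true).  Then the value of a node is the value of the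
-- game from it, so the trees whose roots are labelled (k+1 , true) and
-- (k+1 , false) are separated by φ_{k+1}.
--
-- An embedding-closed quantifier is preserved along embeddings, so in the
-- Ehrenfeucht–Fraïssé game for L_∞ω(Q_emb) a round is an injection in each
-- direction.  Below a node either all children have its value or infinitely
-- many children have each value; hence the partial isomorphism between the
-- nodes played so far extends to an injection of the whole tree that sends
-- each new child to a fresh child with the same value, or at least the same
-- level when that level is beyond the rounds remaining.  So the two trees
-- cannot be separated with fewer than k+1 nested quantifiers.

open import Defs
open import Level using (Level; Lift; lift; lower; _⊔_) renaming (zero to 0ℓ; suc to lsuc)
open import Data.Nat
  using (ℕ; zero; suc; _+_; _∸_; _≤_; _<_; _≟_; z≤n; s≤s; ⌊_/2⌋) renaming (_⊔_ to _⊔ℕ_)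
open import Data.Nat.Properties
  using (+-suc; +-comm; <⇒≤; <⇒≱; ≤-refl; ≤-trans; n≤1+n; m≤m+n; m+n∸m≡n; m≤m⊔n; m≤n⊔m)
open import Data.Bool using (Bool; true; false; not; T; _∧_; _∨_)
open import Data.Bool.Properties using (not-involutive; not-¬)
open import Data.Unit using (⊤; tt)
open import Data.Empty using (⊥; ⊥-elim)
open import Data.Fin using (Fin; zero; suc; splitAt; fromℕ; inject₁)
open import Data.Fin.Properties using (any?)
open import Data.Product using (Σ; _×_; _,_; proj₁; proj₂)
open import Data.Product.Function.NonDependent.Propositional using (_×-⇔_)
open import Data.Sum using (_⊎_; inj₁; inj₂; [_,_]′)
open import Data.Sum.Function.Propositional using (_⊎-⇔_)
open import Data.List using (List; []; _∷_; foldr)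
open import Data.List.Properties using (≡-dec; ∷-injective)
import Data.Vec.Functional as Vector
open Vector using (Vector; _++_; tail) renaming ([] to []ᵥ; _∷_ to _∷ᵥ_)
open import Data.Vec.Functional.Properties using (∷-cong; ++-cong)
open import Relation.Nullary using (¬_; Dec; yes; no)
open import Relation.Nullary.Decidable using (_⊎-dec_)
open import Relation.Binary.PropositionalEquality
  using (_≡_; _≗_; refl; sym; trans; cong; cong₂; subst; subst₂; module ≡-Reasoning)
open import Function using (_∘_; id; case_of_)
open import Function.Bundles using (_⇔_; mk⇔; Equivalence)
open import Function.Related.TypeIsomorphisms using (¬-cong-⇔)
open import Function.Properties.Equivalence using () renaming (trans to ⇔-trans; sym to ⇔-sym)

open Equivalence using (to; from)

-- Invariance under back-and-forth systems of injections

-- Relations are predicates on functions, so without function extensionality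
-- their invariance under pointwise equality has to be assumed.
Extensional : ∀ {a ℓ} {τ : Vocab a} → Structure τ ℓ → Set (a ⊔ ℓ)
Extensional {τ = τ} 𝔄 =
  ∀ R {t t' : Fin (arity τ R) → Carrier 𝔄} → t ≗ t' → rel 𝔄 R t → rel 𝔄 R t'

module _ {a ℓ} {τ : Vocab a} {𝔄 : Structure τ ℓ} (ext : Extensional 𝔄) where

  Sat-resp-≗ : ∀ {n} (φ : Fm ℓ τ n) {e e'} → e ≗ e' → Sat 𝔄 φ e → Sat 𝔄 φ e'
  Sat-resp-≗ (atom R v)     e≗e' s       = ext R (e≗e' ∘ v) s
  Sat-resp-≗ (eq i j)       e≗e' s       = trans (sym (e≗e' i)) (trans s (e≗e' j))
  Sat-resp-≗ (neg φ)        e≗e' s s'    = s (Sat-resp-≗ φ (sym ∘ e≗e') s')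
  Sat-resp-≗ (conj I φ)     e≗e' s i     = Sat-resp-≗ (φ i) e≗e' (s i)
  Sat-resp-≗ (disj I φ)     e≗e' (i , s) = i , Sat-resp-≗ (φ i) e≗e' s
  Sat-resp-≗ (ex φ)         e≗e' (x , s) = x , Sat-resp-≗ φ (∷-cong refl e≗e') s
  Sat-resp-≗ (all φ)        e≗e' s x     = Sat-resp-≗ φ (∷-cong refl e≗e') (s x)
  Sat-resp-≗ (gq σ K emb ψ) e≗e' s       = emb _ _ record
    { map       = id
    ; injective = λ _ _ → id
    ; preserves = λ R t → mk⇔ (Sat-resp-≗ (ψ R) (++-cong t t (λ _ → refl) e≗e'))
                               (Sat-resp-≗ (ψ R) (++-cong t t (λ _ → refl) (sym ∘ e≗e')))
    } s

  Sat-cong-≗ : ∀ {n} (φ : Fm ℓ τ n) {e e'} → e ≗ e' → Sat 𝔄 φ e ⇔ Sat 𝔄 φ e'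
  Sat-cong-≗ φ e≗e' = mk⇔ (Sat-resp-≗ φ e≗e') (Sat-resp-≗ φ (sym ∘ e≗e'))

∷-as-++ : ∀ {c} {C : Set c} {n} (x : C) (e : Vector C n) → (x ∷ᵥ e) ≗ ((λ _ → x) ++ e)
∷-as-++ x e zero    = refl
∷-as-++ x e (suc i) = refl

record BackAndForth {a ℓ} {τ : Vocab a} (𝔄 𝔅 : Structure τ ℓ) (z : Level) :
                    Set (a ⊔ ℓ ⊔ lsuc z) where
  field
    Position : ℕ → ∀ {k} → Vector (Carrier 𝔄) k → Vector (Carrier 𝔅) k → Set z
    atom-⇔   : ∀ {m k} {e : Vector (Carrier 𝔄) k} {e'} → Position m e e' →
               ∀ R (v : Fin (arity τ R) → Fin k) → rel 𝔄 R (e ∘ v) ⇔ rel 𝔅 R (e' ∘ v)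
    eq-⇔     : ∀ {m k} {e : Vector (Carrier 𝔄) k} {e'} → Position m e e' →
               ∀ i j → (e i ≡ e j) ⇔ (e' i ≡ e' j)
    forth    : ∀ {m k} {e : Vector (Carrier 𝔄) k} {e'} → Position (suc m) e e' →
               Σ (Carrier 𝔄 → Carrier 𝔅) λ f → (∀ x y → f x ≡ f y → x ≡ y) ×
                 (∀ {k'} (t : Vector (Carrier 𝔄) k') → Position m (t ++ e) ((f ∘ t) ++ e'))
    back     : ∀ {m k} {e : Vector (Carrier 𝔄) k} {e'} → Position (suc m) e e' →
               Σ (Carrier 𝔅 → Carrier 𝔄) λ g → (∀ x y → g x ≡ g y → x ≡ y) ×
                 (∀ {k'} (t : Vector (Carrier 𝔅) k') → Position m ((g ∘ t) ++ e) (t ++ e'))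

module _ {a ℓ z} {τ : Vocab a} {𝔄 𝔅 : Structure τ ℓ}
         (ext𝔄 : Extensional 𝔄) (ext𝔅 : Extensional 𝔅) (game : BackAndForth 𝔄 𝔅 z) where

  open BackAndForth game

  Sat-preserved : ∀ m {k} (φ : Fm ℓ τ k) {e e'} → Position m e e' → RankLe m φ →
                  Sat 𝔄 φ e ⇔ Sat 𝔅 φ e'

  Sat-preserved-∷ : ∀ m {k} (φ : Fm ℓ τ (suc k)) {e e' x y} →
                    Position m ((λ _ → x) ++ e) ((λ _ → y) ++ e') → RankLe m φ →
                    Sat 𝔄 φ (x ∷ᵥ e) ⇔ Sat 𝔅 φ (y ∷ᵥ e')
  Sat-preserved-∷ m φ {e} {e'} p r =
    ⇔-trans (Sat-cong-≗ ext𝔄 φ (∷-as-++ _ e))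
      (⇔-trans (Sat-preserved m φ p r) (⇔-sym (Sat-cong-≗ ext𝔅 φ (∷-as-++ _ e'))))

  Sat-preserved m (atom R v) p r = atom-⇔ p R v
  Sat-preserved m (eq i j)   p r = eq-⇔ p i j
  Sat-preserved m (neg φ)    p r = ¬-cong-⇔ (Sat-preserved m φ p r)
  Sat-preserved m (conj I φ) p r =
    mk⇔ (λ s i → to (Sat-preserved m (φ i) p (r i)) (s i))
        (λ s i → from (Sat-preserved m (φ i) p (r i)) (s i))
  Sat-preserved m (disj I φ) p r =
    mk⇔ (λ (i , s) → i , to (Sat-preserved m (φ i) p (r i)) s)
        (λ (i , s) → i , from (Sat-preserved m (φ i) p (r i)) s)
  Sat-preserved (suc m) (ex φ) p r with forth p | back p
  ... | f , _ , f-pos | g , _ , g-pos =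
    mk⇔ (λ (x , s) → f x , to (Sat-preserved-∷ m φ (f-pos (λ _ → x)) r) s)
        (λ (y , s) → g y , from (Sat-preserved-∷ m φ (g-pos (λ _ → y)) r) s)
  Sat-preserved (suc m) (all φ) p r with forth p | back p
  ... | f , _ , f-pos | g , _ , g-pos =
    mk⇔ (λ s y → to (Sat-preserved-∷ m φ (g-pos (λ _ → y)) r) (s (g y)))
        (λ s x → from (Sat-preserved-∷ m φ (f-pos (λ _ → x)) r) (s (f x)))
  Sat-preserved (suc m) (gq σ K emb ψ) p r with forth p | back p
  ... | f , f-inj , f-pos | g , g-inj , g-pos =
    mk⇔ (emb _ _ record { map = f ; injective = f-inj
                        ; preserves = λ R t → Sat-preserved m (ψ R) (f-pos t) (r R) })
        (emb _ _ record { map = g ; injective = g-inj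
                        ; preserves = λ R t → ⇔-sym (Sat-preserved m (ψ R) (g-pos t) (r R)) })

odd : ℕ → Bool
odd zero    = false
odd (suc n) = not (odd n)

-- true stands for ∀ and false for ∃, so that Q_j is Quantify (odd j).
Quantify : ∀ {ℓ} → Bool → (C : Set ℓ) → (C → Set ℓ) → Set ℓ
Quantify true  C P = ∀ x → P x
Quantify false C P = Σ C P

module _ {ℓ} {C : Set ℓ} where

  Quantify-map : ∀ b {P P' : C → Set ℓ} → (∀ x → P x → P' x) →
                 Quantify b C P → Quantify b C P'
  Quantify-map true  P⇒P' s       = λ x → P⇒P' x (s x)
  Quantify-map false P⇒P' (x , s) = x , P⇒P' x s

  Quantify-cong : ∀ {b b'} {P P' : C → Set ℓ} → b ≡ b' → (∀ x → P x ⇔ P' x) →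
                  Quantify b C P ⇔ Quantify b' C P'
  Quantify-cong {b} refl P⇔P' =
    mk⇔ (Quantify-map b (λ x → to (P⇔P' x))) (Quantify-map b (λ x → from (P⇔P' x)))

  Quantify-const : C → ∀ b {A : Set ℓ} → Quantify b C (λ _ → A) ⇔ A
  Quantify-const c true  = mk⇔ (λ s → s c) (λ a _ → a)
  Quantify-const c false = mk⇔ proj₂ (c ,_)

module _ {a ℓ} {τ : Vocab a} (𝔄 : Structure τ ℓ) where

  Qlab-sat : ∀ j {n} (φ : Fm ℓ τ (suc n)) e →
             Sat 𝔄 (Qlab j φ) e ⇔ Quantify (odd j) (Carrier 𝔄) (λ x → Sat 𝔄 φ (x ∷ᵥ e))
  Qlab-sat zero          φ e = mk⇔ id id
  Qlab-sat (suc zero)    φ e = mk⇔ id id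
  Qlab-sat (suc (suc j)) φ e =
    ⇔-trans (Qlab-sat j φ e) (Quantify-cong (sym (not-involutive (odd j))) (λ _ → mk⇔ id id))

_∷ʳ_ : ∀ {c} {C : Set c} {m} → Vector C m → C → Vector C (suc m)
_∷ʳ_ {m = zero}  e x _       = x
_∷ʳ_ {m = suc m} e x zero    = e zero
_∷ʳ_ {m = suc m} e x (suc i) = (tail e ∷ʳ x) i

module _ {c} {C : Set c} where

  ∷ʳ-last : ∀ {m} (e : Vector C m) x → (e ∷ʳ x) (fromℕ m) ≡ x
  ∷ʳ-last {zero}  e x = refl
  ∷ʳ-last {suc m} e x = ∷ʳ-last (tail e) x

  ∷ʳ-inject₁ : ∀ {m} (e : Vector C m) x i → (e ∷ʳ x) (inject₁ i) ≡ e i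
  ∷ʳ-inject₁ {suc m} e x zero    = refl
  ∷ʳ-inject₁ {suc m} e x (suc i) = ∷ʳ-inject₁ (tail e) x i

  ∷ʳ-cong : ∀ {m} {e e' : Vector C m} → e ≗ e' → ∀ x → (e ∷ʳ x) ≗ (e' ∷ʳ x)
  ∷ʳ-cong {zero}  e≗e' x i       = refl
  ∷ʳ-cong {suc m} e≗e' x zero    = e≗e' zero
  ∷ʳ-cong {suc m} e≗e' x (suc i) = ∷ʳ-cong (e≗e' ∘ suc) x i

  ∷-∷ʳ : ∀ {m} x (e : Vector C m) y → (x ∷ᵥ (e ∷ʳ y)) ≗ ((x ∷ᵥ e) ∷ʳ y)
  ∷-∷ʳ x e y zero    = refl
  ∷-∷ʳ x e y (suc i) = refl

module _ {ℓ} {C : Set ℓ} where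

  Respects≗ : ∀ {m} → (Vector C m → Set ℓ) → Set ℓ
  Respects≗ S = ∀ {e e'} → e ≗ e' → S e ⇔ S e'

  -- Prefix j m S is the meaning of Q_{j+m} x_{j+m} ⋯ Q_{j+1} x_{j+1} S, the
  -- outermost variable being the last entry of the environment.
  Prefix : ℕ → (m : ℕ) → (Vector C m → Set ℓ) → Set ℓ
  Prefix j zero    S = S []ᵥ
  Prefix j (suc m) S = Quantify (odd (j + suc m)) C λ x → Prefix j m (λ e → S (e ∷ʳ x))

  Prefix-map : ∀ j m {S S' : Vector C m → Set ℓ} → (∀ e → S e → S' e) →
               Prefix j m S → Prefix j m S'
  Prefix-map j zero    S⇒S' = S⇒S' []ᵥ
  Prefix-map j (suc m) S⇒S' = Quantify-map _ (λ x → Prefix-map j m (λ e → S⇒S' (e ∷ʳ x)))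

  Prefix-cong : ∀ j m {S S' : Vector C m → Set ℓ} → (∀ e → S e ⇔ S' e) →
                Prefix j m S ⇔ Prefix j m S'
  Prefix-cong j m S⇔S' =
    mk⇔ (Prefix-map j m (λ e → to (S⇔S' e))) (Prefix-map j m (λ e → from (S⇔S' e)))

  Prefix-const : C → ∀ j m {A : Set ℓ} → Prefix j m (λ _ → A) ⇔ A
  Prefix-const c j zero    = mk⇔ id id
  Prefix-const c j (suc m) =
    ⇔-trans (Quantify-cong refl (λ _ → Prefix-const c j m)) (Quantify-const c _)

  Prefix-innermost : ∀ j m (S : Vector C (suc m) → Set ℓ) → Respects≗ S →
    Prefix (suc j) m (λ e → Quantify (odd (suc j)) C λ x → S (x ∷ᵥ e)) ⇔ Prefix j (suc m) S
  Prefix-innermost j zero S resp =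
    Quantify-cong (cong odd (+-comm 1 j)) (λ x → resp λ { zero → refl })
  Prefix-innermost j (suc m) S resp =
    Quantify-cong (cong odd (sym (+-suc j (suc m)))) λ y →
      ⇔-trans (Prefix-cong (suc j) m (λ e → Quantify-cong refl λ x → resp (∷-∷ʳ x e y)))
              (Prefix-innermost j m (λ e → S (e ∷ʳ y)) (λ e≗e' → resp (∷ʳ-cong e≗e' y)))

prefix-sat : ∀ {a ℓ} {τ : Vocab a} {𝔄 : Structure τ ℓ} → Extensional 𝔄 →
             ∀ j m (θ : Fm ℓ τ m) → Sat 𝔄 (prefix j m θ) []ᵥ ⇔ Prefix j m (Sat 𝔄 θ)
prefix-sat ext j zero    θ = mk⇔ id id
prefix-sat {𝔄 = 𝔄} ext j (suc m) θ =
  ⇔-trans (prefix-sat ext (suc j) m (Qlab (suc j) θ))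
    (⇔-trans (Prefix-cong (suc j) m (Qlab-sat 𝔄 (suc j) θ))
             (Prefix-innermost j m (Sat 𝔄 θ) (Sat-cong-≗ ext θ)))

Relativise : ∀ {ℓ} → Bool → Set ℓ → Set ℓ → Set ℓ
Relativise true  X Y = ¬ X ⊎ Y
Relativise false X Y = X × Y

Relativise-cong : ∀ {ℓ} o {X X' Y Y' : Set ℓ} → X ⇔ X' → Y ⇔ Y' →
                  Relativise o X Y ⇔ Relativise o X' Y'
Relativise-cong true  X⇔X' Y⇔Y' = ¬-cong-⇔ X⇔X' ⊎-⇔ Y⇔Y'
Relativise-cong false X⇔X' Y⇔Y' = X⇔X' ×-⇔ Y⇔Y'

module _ {a} {τ : Vocab a} where

  relativise : ∀ {n} → Bool → QF τ n → QF τ n → QF τ n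
  relativise true  φ ψ = or (neg φ) ψ
  relativise false φ ψ = and φ ψ

  rename : ∀ {n n'} → (Fin n → Fin n') → QF τ n → QF τ n'
  rename ρ (atom R v) = atom R (ρ ∘ v)
  rename ρ (eq i j)   = eq (ρ i) (ρ j)
  rename ρ (neg φ)    = neg (rename ρ φ)
  rename ρ (and φ ψ)  = and (rename ρ φ) (rename ρ ψ)
  rename ρ (or φ ψ)   = or (rename ρ φ) (rename ρ ψ)

  module Semantics {ℓ} (𝔄 : Structure τ ℓ) where

    ⟦_⟧ : ∀ {n} → QF τ n → Vector (Carrier 𝔄) n → Set ℓ
    ⟦ atom R v ⟧ e = rel 𝔄 R (e ∘ v)
    ⟦ eq i j ⟧   e = e i ≡ e j
    ⟦ neg φ ⟧    e = ¬ ⟦ φ ⟧ e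
    ⟦ and φ ψ ⟧  e = ⟦ φ ⟧ e × ⟦ ψ ⟧ e
    ⟦ or φ ψ ⟧   e = ⟦ φ ⟧ e ⊎ ⟦ ψ ⟧ e

    qf-sat : ∀ {n} (φ : QF τ n) e → Sat 𝔄 (qf ℓ φ) e ⇔ ⟦ φ ⟧ e
    qf-sat (atom R v) e = mk⇔ id id
    qf-sat (eq i j)   e = mk⇔ id id
    qf-sat (neg φ)    e = ¬-cong-⇔ (qf-sat φ e)
    qf-sat (and φ ψ)  e =
      mk⇔ (λ s → to (qf-sat φ e) (s (lift true)) , to (qf-sat ψ e) (s (lift false)))
          (λ { (s , t) (lift true) → from (qf-sat φ e) s ; (s , t) (lift false) → from (qf-sat ψ e) t })
    qf-sat (or φ ψ)   e =
      mk⇔ (λ { (lift true , s) → inj₁ (to (qf-sat φ e) s)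
             ; (lift false , t) → inj₂ (to (qf-sat ψ e) t) })
          (λ { (inj₁ s) → lift true , from (qf-sat φ e) s
             ; (inj₂ t) → lift false , from (qf-sat ψ e) t })

    ⟦⟧-cong-≗ : Extensional 𝔄 → ∀ {n} (φ : QF τ n) → Respects≗ ⟦ φ ⟧
    ⟦⟧-cong-≗ ext φ {e} {e'} e≗e' =
      ⇔-trans (⇔-sym (qf-sat φ e)) (⇔-trans (Sat-cong-≗ ext (qf ℓ φ) e≗e') (qf-sat φ e'))

    ⟦relativise⟧ : ∀ {n} o (φ ψ : QF τ n) e →
                   ⟦ relativise o φ ψ ⟧ e ⇔ Relativise o (⟦ φ ⟧ e) (⟦ ψ ⟧ e)
    ⟦relativise⟧ true  φ ψ e = mk⇔ id id
    ⟦relativise⟧ false φ ψ e = mk⇔ id id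

    ⟦rename⟧ : ∀ {n n'} (ρ : Fin n → Fin n') (φ : QF τ n) e →
               ⟦ rename ρ φ ⟧ e ⇔ ⟦ φ ⟧ (e ∘ ρ)
    ⟦rename⟧ ρ (atom R v) e = mk⇔ id id
    ⟦rename⟧ ρ (eq i j)   e = mk⇔ id id
    ⟦rename⟧ ρ (neg φ)    e = ¬-cong-⇔ (⟦rename⟧ ρ φ e)
    ⟦rename⟧ ρ (and φ ψ)  e = ⟦rename⟧ ρ φ e ×-⇔ ⟦rename⟧ ρ ψ e
    ⟦rename⟧ ρ (or φ ψ)   e = ⟦rename⟧ ρ φ e ⊎-⇔ ⟦rename⟧ ρ ψ e

-- Labelled trees

-- A label (j , s) says that Q_j is played at the node and that the game
-- from there has value s.  Below a universal node of value true, or an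
-- existential node of value false, every child has the value of its parent;
-- below any other node a child of colour false (even index) has value true
-- and a child of colour true (odd index) value false.  Labels below level 0
-- are never looked at.
Label : Set
Label = ℕ × Bool

childValue : Bool → Bool → Bool → Bool
childValue true  s c = s ∨ not c
childValue false s c = s ∧ not c

childLabel : Label → Bool → Label
childLabel (zero  , s) c = zero , s
childLabel (suc j , s) c = j , childValue (odd (suc j)) s c

childValue-uniform : ∀ o c → childValue o o c ≡ o
childValue-uniform true  c = refl
childValue-uniform false c = refl

childValue-not : ∀ o s t → childValue o s (not t) ≡ t ⊎ (s ≡ o × t ≡ not o)
childValue-not true  true  true  = inj₁ refl
childValue-not true  true  false = inj₂ (refl , refl)
childValue-not true  false t     = inj₁ (not-involutive t)
childValue-not false true  t     = inj₁ (not-involutive t)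
childValue-not false false true  = inj₂ (refl , refl)
childValue-not false false false = inj₁ refl

-- m more rounds cannot tell apart labels of the same level above m.
Agree : ℕ → Label → Label → Set
Agree m k k' = k ≡ k' ⊎ (proj₁ k ≡ proj₁ k' × m < proj₁ k)

-- k is uniform and k' is not, so every child label of k occurs below k'.
Covers : ℕ → Label → Label → Set
Covers m k k' = k ≡ k' ⊎ (proj₁ k ≡ proj₁ k' × m < proj₁ k ×
                          proj₂ k ≡ odd (proj₁ k) × proj₂ k' ≡ not (odd (proj₁ k)))

module _ {m : ℕ} where

  Agree-weaken : ∀ {k k'} → Agree (suc m) k k' → Agree m k k'
  Agree-weaken (inj₁ k≡k')        = inj₁ k≡k'
  Agree-weaken (inj₂ (same , m<j)) = inj₂ (same , <⇒≤ m<j)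

  Covers⇒Agree : ∀ {k k'} → Covers m k k' → Agree m k k'
  Covers⇒Agree (inj₁ k≡k')           = inj₁ k≡k'
  Covers⇒Agree (inj₂ (same , m<j , _)) = inj₂ (same , m<j)

  Agree-sym : ∀ {k k'} → Agree m k k' → Agree m k' k
  Agree-sym (inj₁ k≡k')         = inj₁ (sym k≡k')
  Agree-sym (inj₂ (refl , m<j)) = inj₂ (refl , m<j)

  Agree-won : ∀ {k k'} → Agree m k k' → k ≡ (zero , true) → k' ≡ (zero , true)
  Agree-won (inj₁ k≡k')      refl = sym k≡k'
  Agree-won (inj₂ (refl , ())) refl

  same-level : ∀ {k k'} → Agree (suc m) k k' ⊎ Covers m k k' → proj₁ k ≡ proj₁ k'
  same-level (inj₁ (inj₁ refl))          = refl
  same-level (inj₁ (inj₂ (same , _)))    = same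
  same-level (inj₂ (inj₁ refl))          = refl
  same-level (inj₂ (inj₂ (same , _)))    = same

  -- The colour chosen below k' gives its child the value of the child of k
  -- whenever that is possible.
  child-covers : ∀ k k' c → Agree (suc m) k k' ⊎ Covers m k k' →
                 Covers m (childLabel k c) (childLabel k' (not (proj₂ (childLabel k c))))
  child-covers (j , s) (j' , s') c rel with same-level rel
  child-covers (zero , s) (zero , s') c (inj₁ (inj₁ refl))        | refl = inj₁ refl
  child-covers (zero , s) (zero , s') c (inj₂ (inj₁ refl))        | refl = inj₁ refl
  child-covers (suc j , s) (suc j , s') c rel | refl
    with childValue-not (odd (suc j)) s' (childValue (odd (suc j)) s c)
  ... | inj₁ same-value = inj₁ (cong (j ,_) (sym same-value))
  ... | inj₂ (s'≡o , t≡¬o) =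
    inj₂ (refl , above rel , trans t≡¬o (not-involutive (odd j)) ,
          trans (cong (λ s' → childValue o s' _) s'≡o) (childValue-uniform o _))
    where
    o : Bool
    o = odd (suc j)
    uniform-parent : s ≡ o → ⊥
    uniform-parent refl = not-¬ (childValue-uniform o c) t≡¬o
    above : Agree (suc m) (suc j , s) (suc j , s') ⊎ Covers m (suc j , s) (suc j , s') → m < j
    above (inj₁ (inj₁ refl))                = ⊥-elim (uniform-parent s'≡o)
    above (inj₁ (inj₂ (_ , s≤s m<j)))       = m<j
    above (inj₂ (inj₁ refl))                = ⊥-elim (uniform-parent s'≡o)
    above (inj₂ (inj₂ (_ , _ , _ , s'≡¬o))) = ⊥-elim (not-¬ s'≡o s'≡¬o)

label : Label → List ℕ → Label
label r []      = r
label r (i ∷ x) = childLabel (label r x) (odd i)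

Child : List ℕ → List ℕ → Set
Child x y = Σ ℕ λ i → y ≡ i ∷ x

infix 4 _≼_ _≼?_

-- x ≼ y : x is an ancestor of y (a suffix of the list y).
data _≼_ : List ℕ → List ℕ → Set where
  ≼-refl : ∀ {x} → x ≼ x
  ≼-step : ∀ {x i y} → x ≼ y → x ≼ i ∷ y

≼-parent : ∀ {i x y} → i ∷ x ≼ y → x ≼ y
≼-parent ≼-refl     = ≼-step ≼-refl
≼-parent (≼-step p) = ≼-step (≼-parent p)

≼-∷⁻ : ∀ {x i y} → x ≼ i ∷ y → x ≡ i ∷ y ⊎ x ≼ y
≼-∷⁻ ≼-refl     = inj₁ refl
≼-∷⁻ (≼-step p) = inj₂ p

_≼?_ : ∀ x y → Dec (x ≼ y)
x ≼? [] with ≡-dec _≟_ x []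
... | yes refl = yes ≼-refl
... | no x≢[]  = no λ { ≼-refl → x≢[] refl }
x ≼? i ∷ y with ≡-dec _≟_ x (i ∷ y) | x ≼? y
... | yes refl | _      = yes ≼-refl
... | no x≢iy  | yes p  = yes (≼-step p)
... | no x≢iy  | no ¬p  = no λ { ≼-refl → x≢iy refl ; (≼-step p) → ¬p p }

maxEntry : List ℕ → ℕ
maxEntry = foldr _⊔ℕ_ 0

≼-maxEntry : ∀ {x y} → x ≼ y → maxEntry x ≤ maxEntry y
≼-maxEntry ≼-refl             = ≤-refl
≼-maxEntry (≼-step {i = i} p) = ≤-trans (≼-maxEntry p) (m≤n⊔m i _)

maxEntries : ∀ {k} → Vector (List ℕ) k → ℕ
maxEntries = Vector.foldr (λ x n → maxEntry x ⊔ℕ n) 0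

maxEntry≤maxEntries : ∀ {k} (E : Vector (List ℕ) k) j → maxEntry (E j) ≤ maxEntries E
maxEntry≤maxEntries E zero    = m≤m⊔n _ _
maxEntry≤maxEntries E (suc j) = ≤-trans (maxEntry≤maxEntries (tail E) j) (m≤n⊔m _ _)

module _ {k} (E : Vector (List ℕ) k) where

  Spanned : List ℕ → Set
  Spanned x = x ≡ [] ⊎ Σ (Fin k) λ j → x ≼ E j

  Spanned? : ∀ x → Dec (Spanned x)
  Spanned? x = ≡-dec _≟_ x [] ⊎-dec any? (λ j → x ≼? E j)

  Spanned-parent : ∀ {i x} → Spanned (i ∷ x) → Spanned x
  Spanned-parent (inj₂ (j , p)) = inj₂ (j , ≼-parent p)

  Spanned-index< : ∀ {q y} → Spanned (q ∷ y) → q < suc (maxEntries E)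
  Spanned-index< {q} {y} (inj₂ (j , p)) =
    s≤s (≤-trans (m≤m⊔n q (maxEntry y)) (≤-trans (≼-maxEntry p) (maxEntry≤maxEntries E j)))

  Spanned-E : ∀ j → Spanned (E j)
  Spanned-E j = inj₂ (j , ≼-refl)

-- The back-and-forth system between two trees

record TreeMap {k} (E E' : Vector (List ℕ) k) : Set where
  field
    fun       : List ℕ → List ℕ
    fun-E     : ∀ j → fun (E j) ≡ E' j
    fun-root  : fun [] ≡ []
    fun-child : ∀ {i x} → Spanned E (i ∷ x) → Σ ℕ λ q → fun (i ∷ x) ≡ q ∷ fun x

  fun-≼ : ∀ {x y} → Spanned E y → x ≼ y → fun x ≼ fun y
  fun-≼ y∈E ≼-refl = ≼-refl
  fun-≼ y∈E (≼-step {i = i} {y = y} p) with fun-child {i} {y} y∈E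
  ... | q , fun-iy = subst (fun _ ≼_) (sym fun-iy) (≼-step (fun-≼ (Spanned-parent E y∈E) p))

  fun-Spanned : ∀ {x} → Spanned E x → Spanned E' (fun x)
  fun-Spanned (inj₁ refl)    = inj₁ fun-root
  fun-Spanned (inj₂ (j , p)) = inj₂ (j , subst (fun _ ≼_) (fun-E j) (fun-≼ (Spanned-E E j) p))

  fun-Child : ∀ {x y} → Spanned E y → Child x y → Child (fun x) (fun y)
  fun-Child y∈E (i , refl) = fun-child y∈E

data Symbol : Set where
  edge top won : Symbol

τ : Vocab 0ℓ
τ = record { Sym = Symbol ; arity = λ { edge → 2 ; top → 1 ; won → 1 } }

Holds : Label → (R : Symbol) → (Fin (arity τ R) → List ℕ) → Set
Holds r edge t = Child (t zero) (t (suc zero))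
Holds r top  t = Child [] (t zero)
Holds r won  t = label r (t zero) ≡ (zero , true)

record PartialIso (m : ℕ) (rA rB : Label) {k} (E E' : Vector (List ℕ) k) : Set where
  field
    fwd          : TreeMap E E'
    bwd          : TreeMap E' E
  open TreeMap fwd renaming (fun to h) public
  open TreeMap bwd using () renaming (fun to h⁻¹) public
  field
    h⁻¹∘h        : ∀ {x} → Spanned E x → h⁻¹ (h x) ≡ x
    h∘h⁻¹        : ∀ {y} → Spanned E' y → h (h⁻¹ y) ≡ y
    labels-agree : ∀ {x} → Spanned E x → Agree m (label rA x) (label rB (h x))

transport-≡ : ∀ {k} {E E' : Vector (List ℕ) k} → TreeMap E E' →
              ∀ {i j} → E i ≡ E j → E' i ≡ E' j
transport-≡ F {i} {j} Ei≡Ej = trans (sym (fun-E i)) (trans (cong fun Ei≡Ej) (fun-E j))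
  where open TreeMap F

module _ {m rA rB k} {E E' : Vector (List ℕ) k} (P : PartialIso m rA rB E E') where

  open PartialIso P

  swap : PartialIso m rB rA E' E
  swap = record
    { fwd = bwd ; bwd = fwd ; h⁻¹∘h = h∘h⁻¹ ; h∘h⁻¹ = h⁻¹∘h
    ; labels-agree = λ {y} y∈E' →
        Agree-sym (subst (Agree m (label rA (h⁻¹ y)) ∘ label rB) (h∘h⁻¹ y∈E')
                         (labels-agree (TreeMap.fun-Spanned bwd y∈E')))
    }

  PartialIso-Holds : ∀ R (v : Fin (arity τ R) → Fin k) → Holds rA R (E ∘ v) → Holds rB R (E' ∘ v)
  PartialIso-Holds edge v c = subst₂ Child (fun-E (v zero)) (fun-E (v (suc zero)))
                                     (fun-Child (Spanned-E E (v (suc zero))) c)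
  PartialIso-Holds top  v c = subst₂ Child fun-root (fun-E (v zero)) (fun-Child (Spanned-E E (v zero)) c)
  PartialIso-Holds won  v w = subst (λ x → label rB x ≡ (zero , true)) (fun-E (v zero))
                                  (Agree-won (labels-agree (Spanned-E E (v zero))) w)

  PartialIso-≡ : ∀ i j → (E i ≡ E j) ⇔ (E' i ≡ E' j)
  PartialIso-≡ i j = mk⇔ (transport-≡ fwd) (transport-≡ bwd)

tagged : ℕ → Bool → ℕ
tagged zero    false = 0
tagged zero    true  = 1
tagged (suc n) c     = suc (suc (tagged n c))

odd-tagged : ∀ n c → odd (tagged n c) ≡ c
odd-tagged zero    false = refl
odd-tagged zero    true  = refl
odd-tagged (suc n) c     = trans (not-involutive _) (odd-tagged n c)

⌊tagged/2⌋ : ∀ n c → ⌊ tagged n c /2⌋ ≡ n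
⌊tagged/2⌋ zero    false = refl
⌊tagged/2⌋ zero    true  = refl
⌊tagged/2⌋ (suc n) c     = cong suc (⌊tagged/2⌋ n c)

≤-tagged : ∀ n c → n ≤ tagged n c
≤-tagged zero    c = z≤n
≤-tagged (suc n) c = s≤s (≤-trans (≤-tagged n c) (n≤1+n _))

-- One round of the game: a position with m + 1 rounds left yields a single
-- injection f on the whole tree, good for every continuation.  On the spanned
-- part f is the partial isomorphism; elsewhere the i-th child goes to a fresh
-- child (index beyond all of E') whose colour makes its label cover the original.
module Extend {m rA rB k} {E E' : Vector (List ℕ) k} (P : PartialIso (suc m) rA rB E E') where

  open PartialIso P
  open ≡-Reasoning

  N : ℕ
  N = suc (maxEntries E')

  childIndex : ℕ → List ℕ → ℕ
  childIndex i x with Spanned? E (i ∷ x)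
  ... | yes i∷x∈E = proj₁ (fun-child i∷x∈E)
  ... | no _      = tagged (N + i) (not (proj₂ (label rA (i ∷ x))))

  f : List ℕ → List ℕ
  f []      = []
  f (i ∷ x) = childIndex i x ∷ f x

  parentIndex : ℕ → List ℕ → ℕ
  parentIndex q y with Spanned? E' (q ∷ y)
  ... | yes q∷y∈E' = proj₁ (TreeMap.fun-child bwd q∷y∈E')
  ... | no _       = ⌊ q /2⌋ ∸ N

  g : List ℕ → List ℕ
  g []      = []
  g (q ∷ y) = parentIndex q y ∷ g y

  f≡h : ∀ {x} → Spanned E x → f x ≡ h x
  f≡h {[]}    _      = sym fun-root
  f≡h {i ∷ x} i∷x∈E with Spanned? E (i ∷ x)
  ... | yes i∷x∈E' =
    trans (cong (_ ∷_) (f≡h (Spanned-parent E i∷x∈E))) (sym (proj₂ (fun-child i∷x∈E')))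
  ... | no ∉E      = ⊥-elim (∉E i∷x∈E)

  h-∷-f : ∀ {i x} (i∷x∈E : Spanned E (i ∷ x)) → h (i ∷ x) ≡ proj₁ (fun-child i∷x∈E) ∷ f x
  h-∷-f i∷x∈E =
    trans (proj₂ (fun-child i∷x∈E)) (cong (_ ∷_) (sym (f≡h (Spanned-parent E i∷x∈E))))

  fresh-not-Spanned : ∀ i c y → ¬ Spanned E' (tagged (N + i) c ∷ y)
  fresh-not-Spanned i c y s =
    <⇒≱ (Spanned-index< E' s) (≤-trans (m≤m+n N i) (≤-tagged (N + i) c))

  g∘f : ∀ x → g (f x) ≡ x
  g∘f []      = refl
  g∘f (i ∷ x) = cong₂ _∷_ (parentIndex-childIndex i x) (g∘f x)
    where
    parentIndex-childIndex : ∀ i x → parentIndex (childIndex i x) (f x) ≡ i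
    parentIndex-childIndex i x with Spanned? E (i ∷ x)
    ... | no _ with Spanned? E' (tagged (N + i) (not (proj₂ (label rA (i ∷ x)))) ∷ f x)
    ...   | yes s = ⊥-elim (fresh-not-Spanned i _ (f x) s)
    ...   | no _  = trans (cong (_∸ N) (⌊tagged/2⌋ (N + i) _)) (m+n∸m≡n N i)
    parentIndex-childIndex i x | yes i∷x∈E with Spanned? E' (proj₁ (fun-child i∷x∈E) ∷ f x)
    ...   | no ∉E'     = ⊥-elim (∉E' (subst (Spanned E') (h-∷-f i∷x∈E) (fun-Spanned i∷x∈E)))
    ...   | yes q∷fx∈E' = proj₁ (∷-injective (begin
      _ ∷ h⁻¹ (f x)                        ≡⟨ proj₂ (TreeMap.fun-child bwd q∷fx∈E') ⟨
      h⁻¹ (proj₁ (fun-child i∷x∈E) ∷ f x)  ≡⟨ cong h⁻¹ (h-∷-f i∷x∈E) ⟨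
      h⁻¹ (h (i ∷ x))                       ≡⟨ h⁻¹∘h i∷x∈E ⟩
      i ∷ x                                 ∎))

  f-injective : ∀ x y → f x ≡ f y → x ≡ y
  f-injective x y fx≡fy = trans (sym (g∘f x)) (trans (cong g fx≡fy) (g∘f y))

  ≼-f : ∀ z {y} → y ≼ f z → Σ (List ℕ) λ x → f x ≡ y
  ≼-f []      ≼-refl = [] , refl
  ≼-f (i ∷ z) p with ≼-∷⁻ p
  ... | inj₁ refl = i ∷ z , refl
  ... | inj₂ q    = ≼-f z q

  labels-related : ∀ x → Agree (suc m) (label rA x) (label rB (f x)) ⊎
                         Covers m (label rA x) (label rB (f x))
  labels-related []      = inj₁ (subst (Agree (suc m) rA ∘ label rB) fun-root (labels-agree (inj₁ refl)))
  labels-related (i ∷ x) with Spanned? E (i ∷ x)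
  ... | yes i∷x∈E = inj₁ (subst (Agree (suc m) (label rA (i ∷ x)) ∘ label rB) (h-∷-f i∷x∈E)
                                (labels-agree i∷x∈E))
  ... | no _      = inj₂ (subst (Covers m (label rA (i ∷ x)) ∘ childLabel (label rB (f x)))
                                (sym (odd-tagged (N + i) _))
                                (child-covers (label rA x) (label rB (f x)) (odd i) (labels-related x)))

  extend : ∀ {k'} (E₁ E₁' : Vector (List ℕ) k') → (∀ j → f (E₁ j) ≡ E₁' j) →
           PartialIso m rA rB E₁ E₁'
  extend E₁ E₁' f-E₁ = record
    { fwd          = record { fun = f ; fun-E = f-E₁ ; fun-root = refl ; fun-child = λ _ → _ , refl }
    ; bwd          = record { fun = g ; fun-E = g-E₁' ; fun-root = refl ; fun-child = λ _ → _ , refl }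
    ; h⁻¹∘h        = λ {x} _ → g∘f x
    ; h∘h⁻¹        = f∘g
    ; labels-agree = λ {x} _ → [ Agree-weaken , Covers⇒Agree ]′ (labels-related x)
    }
    where
    g-E₁' : ∀ j → g (E₁' j) ≡ E₁ j
    g-E₁' j = trans (cong g (sym (f-E₁ j))) (g∘f (E₁ j))
    f∘g : ∀ {y} → Spanned E₁' y → f (g y) ≡ y
    f∘g (inj₁ refl) = refl
    f∘g (inj₂ (j , y≼E₁'j)) with ≼-f (E₁ j) (subst (_ ≼_) (sym (f-E₁ j)) y≼E₁'j)
    ... | x , refl = cong f (g∘f x)

  f-E : ∀ j → f (E j) ≡ E' j
  f-E j = trans (f≡h (Spanned-E E j)) (fun-E j)

map-++ : ∀ {a b} {A : Set a} {B : Set b} (φ : A → B) {k k'} (t : Vector A k') {e : Vector A k} {e'} →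
         (∀ j → φ (e j) ≡ e' j) → ∀ j → φ ((t ++ e) j) ≡ ((φ ∘ t) ++ e') j
map-++ φ {k' = k'} t φe≡e' j with splitAt k' j
... | inj₁ i = refl
... | inj₂ i = φe≡e' i

tree : (ℓ : Level) → Label → Structure τ ℓ
tree ℓ r = record { Carrier = Lift ℓ (List ℕ) ; rel = λ R t → Lift ℓ (Holds r R (lower ∘ t)) }

tree-extensional : ∀ ℓ r → Extensional (tree ℓ r)
tree-extensional ℓ r R t≗t' (lift w) = lift (Holds-resp R (cong lower ∘ t≗t') w)
  where
  Holds-resp : ∀ R {t t'} → t ≗ t' → Holds r R t → Holds r R t'
  Holds-resp edge t≗t' c = subst₂ Child (t≗t' zero) (t≗t' (suc zero)) c
  Holds-resp top  t≗t' c = subst (Child []) (t≗t' zero) c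
  Holds-resp won  t≗t' w = subst (λ x → label r x ≡ (zero , true)) (t≗t' zero) w

tree-forth : ∀ {ℓ m rA rB k} {e e' : Vector (Lift ℓ (List ℕ)) k} →
  PartialIso (suc m) rA rB (lower ∘ e) (lower ∘ e') →
  Σ (Lift ℓ (List ℕ) → Lift ℓ (List ℕ)) λ f → (∀ x y → f x ≡ f y → x ≡ y) ×
    (∀ {k'} (t : Vector (Lift ℓ (List ℕ)) k') →
       PartialIso m rA rB (lower ∘ (t ++ e)) (lower ∘ ((f ∘ t) ++ e')))
tree-forth P =
  lift ∘ f ∘ lower ,
  (λ x y → cong lift ∘ f-injective (lower x) (lower y) ∘ cong lower) ,
  λ t → extend _ _ (cong lower ∘ map-++ (lift ∘ f ∘ lower) t (cong lift ∘ f-E))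
  where open Extend P

tree-game : ∀ ℓ rA rB → BackAndForth (tree ℓ rA) (tree ℓ rB) 0ℓ
tree-game ℓ rA rB = record
  { Position = λ m e e' → PartialIso m rA rB (lower ∘ e) (lower ∘ e')
  ; atom-⇔   = λ P R v → mk⇔ (λ (lift w) → lift (PartialIso-Holds P R v w))
                             (λ (lift w) → lift (PartialIso-Holds (swap P) R v w))
  ; eq-⇔     = λ P i j → mk⇔ (cong lift ∘ to (PartialIso-≡ P i j) ∘ cong lower)
                             (cong lift ∘ from (PartialIso-≡ P i j) ∘ cong lower)
  ; forth    = tree-forth
  ; back     = λ P → let g , g-inj , g-pos = tree-forth (swap P) in g , g-inj , λ t → swap (g-pos t)
  }

-- The sentences and their values

Child? : ∀ x y → Dec (Child x y)
Child? x []      = no λ ()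
Child? x (i ∷ y) with ≡-dec _≟_ y x
... | yes refl = yes (i , refl)
... | no y≢x   = no λ { (_ , refl) → y≢x refl }

-- Variable i of game k is x_{i+1}; in game (k + 1) the atom edge says that
-- x_{k+1} is a child of x_{k+2}.
parentChild : ∀ k → Fin 2 → Fin (suc (suc k))
parentChild k zero    = fromℕ (suc k)
parentChild k (suc _) = inject₁ (fromℕ k)

game : (k : ℕ) → QF τ (suc k)
game zero    = atom won (λ _ → zero)
game (suc k) = relativise (odd (suc k)) (atom edge (parentChild k)) (rename inject₁ (game k))

ϑ : (k : ℕ) → QF τ (suc k)
ϑ k = relativise (odd (suc k)) (atom top (λ _ → fromℕ k)) (game k)

module Evaluation (ℓ : Level) (r : Label) where

  C : Set ℓ
  C = Lift ℓ (List ℕ)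

  open Semantics (tree ℓ r)

  Subgame : ∀ k → List ℕ → Vector C k → Set ℓ
  Subgame k y e = ⟦ game k ⟧ (e ∷ʳ lift y)

  label-child : ∀ {k b o} y i → odd (suc k) ≡ o → label r y ≡ (suc k , b) →
                label r (i ∷ y) ≡ (k , childValue o b (odd i))
  label-child y i refl y-label = cong (λ l → childLabel l (odd i)) y-label

  module _ (k : ℕ) (ih : ∀ z {b} → label r z ≡ (k , b) → Prefix 0 k (Subgame k z) ⇔ T b) where

    AfterMove : Bool → List ℕ → C → Set ℓ
    AfterMove o y x = Prefix 0 k λ e → Relativise o (Lift ℓ (Child y (lower x))) (Subgame k (lower x) e)

    moves-value : ∀ y {b} o → odd (suc k) ≡ o → label r y ≡ (suc k , b) →
                  Quantify o C (AfterMove o y) ⇔ T b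
    moves-value y {true} true o≡ y-label = mk⇔ _ λ _ x → winning (lower x)
      where
      winning : ∀ x → AfterMove true y (lift x)
      winning x with Child? y x
      ... | yes (i , refl) =
        Prefix-map 0 k (λ _ → inj₂) (from (ih (i ∷ y) (label-child y i o≡ y-label)) tt)
      ... | no ¬child      =
        Prefix-map 0 k (λ _ → inj₁) (from (Prefix-const (lift []) 0 k) (¬child ∘ lower))
    moves-value y {false} true o≡ y-label = mk⇔ losing ⊥-elim
      where
      losing : Quantify true C (AfterMove true y) → ⊥
      losing all-moves = to (ih (1 ∷ y) (label-child y 1 o≡ y-label))
        (Prefix-map 0 k (λ _ → [ (λ ¬child → ⊥-elim (¬child (lift (1 , refl)))) , id ]′)
                        (all-moves (lift (1 ∷ y))))
    moves-value y {true} false o≡ y-label = mk⇔ _ λ _ → lift (0 ∷ y) ,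
      Prefix-map 0 k (λ _ → lift (0 , refl) ,_) (from (ih (0 ∷ y) (label-child y 0 o≡ y-label)) tt)
    moves-value y {false} false o≡ y-label = mk⇔ losing ⊥-elim
      where
      losing : Quantify false C (AfterMove false y) → ⊥
      losing (lift x , move) with to (Prefix-const (lift []) 0 k) (Prefix-map 0 k (λ _ → proj₁) move)
      ... | lift (i , refl) =
        to (ih (i ∷ y) (label-child y i o≡ y-label)) (Prefix-map 0 k (λ _ → proj₂) move)

    level-value : ∀ y {b} → label r y ≡ (suc k , b) → (S : Vector C (suc k) → Set ℓ) →
      (∀ x e → S (e ∷ʳ x) ⇔
               Relativise (odd (suc k)) (Lift ℓ (Child y (lower x))) (Subgame k (lower x) e)) →
      Prefix 0 (suc k) S ⇔ T b
    level-value y y-label S S-unfolds =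
      ⇔-trans (Quantify-cong refl λ x → Prefix-cong 0 k (S-unfolds x))
              (moves-value y (odd (suc k)) refl y-label)

  Child-cong : ∀ {x x' y y'} → x ≡ x' → y ≡ y' → Lift ℓ (Child x y) ⇔ Lift ℓ (Child x' y')
  Child-cong refl refl = mk⇔ id id

  Subgame-unfolds : ∀ k z x e → Subgame (suc k) z (e ∷ʳ x) ⇔
    Relativise (odd (suc k)) (Lift ℓ (Child z (lower x))) (Subgame k (lower x) e)
  Subgame-unfolds k z x e =
    ⇔-trans (⟦relativise⟧ _ _ _ _)
      (Relativise-cong _ (Child-cong (cong lower (∷ʳ-last (e ∷ʳ x) (lift z))) (cong lower child-variable))
                         (⇔-trans (⟦rename⟧ inject₁ (game k) _)
                                  (⟦⟧-cong-≗ (tree-extensional ℓ r) (game k) (∷ʳ-inject₁ (e ∷ʳ x) (lift z)))))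
    where
    child-variable : ((e ∷ʳ x) ∷ʳ lift z) (inject₁ (fromℕ k)) ≡ x
    child-variable = trans (∷ʳ-inject₁ (e ∷ʳ x) (lift z) (fromℕ k)) (∷ʳ-last e x)

  ϑ-unfolds : ∀ k x e → ⟦ ϑ k ⟧ (e ∷ʳ x) ⇔
    Relativise (odd (suc k)) (Lift ℓ (Child [] (lower x))) (Subgame k (lower x) e)
  ϑ-unfolds k x e =
    ⇔-trans (⟦relativise⟧ _ _ _ _)
            (Relativise-cong _ (Child-cong refl (cong lower (∷ʳ-last e x))) (mk⇔ id id))

  game-value : ∀ k z {b} → label r z ≡ (k , b) → Prefix 0 k (Subgame k z) ⇔ T b
  game-value zero    z {true}  z-label = mk⇔ _ λ _ → lift z-label
  game-value zero    z {false} z-label =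
    mk⇔ (λ (lift z-won) → case trans (sym z-label) z-won of λ ()) ⊥-elim
  game-value (suc k) z z-label =
    level-value k (game-value k) z z-label (Subgame (suc k) z) (Subgame-unfolds k z)

  sentence-value : ∀ k {b} → r ≡ (suc k , b) → tree ℓ r ⊨ prenexSentence ℓ (suc k) (ϑ k) ⇔ T b
  sentence-value k r-label =
    ⇔-trans (Sat-cong-≗ ext (prenexSentence ℓ (suc k) (ϑ k)) λ ())
      (⇔-trans (prefix-sat ext 0 (suc k) (qf ℓ (ϑ k)))
        (⇔-trans (Prefix-cong 0 (suc k) (qf-sat (ϑ k)))
                 (level-value k (game-value k) [] r-label ⟦ ϑ k ⟧ (ϑ-unfolds k))))
    where
    ext : Extensional (tree ℓ r)
    ext = tree-extensional ℓ r

initial : ∀ k b b' (E E' : Vector (List ℕ) 0) → PartialIso k (suc k , b) (suc k , b') E E'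
initial k b b' E E' = record
  { fwd = identity ; bwd = identity ; h⁻¹∘h = λ _ → refl ; h∘h⁻¹ = λ _ → refl
  ; labels-agree = λ { (inj₁ refl) → inj₂ (refl , ≤-refl) ; (inj₂ (() , _)) } }
  where
  identity : ∀ {E E' : Vector (List ℕ) 0} → TreeMap E E'
  identity = record { fun = id ; fun-E = λ () ; fun-root = refl ; fun-child = λ _ → _ , refl }

rank-equivalent : ∀ ℓ k (ψ : Fm ℓ τ 0) → RankLe k ψ →
                  tree ℓ (suc k , true) ⊨ ψ ⇔ tree ℓ (suc k , false) ⊨ ψ
rank-equivalent ℓ k ψ ψ-rank =
  Sat-preserved (tree-extensional ℓ _) (tree-extensional ℓ _) (tree-game ℓ _ _) k ψ
                (initial k true false _ _) ψ-rank

mainTheorem14 : (n : ℕ) →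
    Σω (Vocab 0ℓ) λ τ → Σω (QF τ n) λ ϑ →
      ∀ (ℓ : Level) (ψ : Fm ℓ τ 0) → RankLt n ψ →
        ¬ (∀ (𝔄 : Structure τ ℓ) → (𝔄 ⊨ prenexSentence ℓ n ϑ) ⇔ (𝔄 ⊨ ψ))
mainTheorem14 zero    = record { Sym = ⊤ ; arity = λ _ → 0 } ,ω (atom tt (λ ()) ,ω λ _ _ ())
mainTheorem14 (suc k) = τ ,ω (ϑ k ,ω λ ℓ ψ ψ-rank defines →
  to (⇔-trans (⇔-sym (sentence-value ℓ (suc k , true) k refl))
     (⇔-trans (defines _)
     (⇔-trans (rank-equivalent ℓ k ψ ψ-rank)
     (⇔-trans (⇔-sym (defines _))
              (sentence-value ℓ (suc k , false) k refl))))) tt)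
  where open Evaluation using (sentence-value)
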